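{- For all $n,m\ge0$, \[ \mathcal{L}(x^nQ_m(x))=\sum_{\pi\in\mathrm{MS}_{n,m}}\mathrm{wt}(\pi), \] where $\mathrm{MS}_{n,m}$ is the set of Motzkin–Schröder paths from $(0,0)$ to $(n,m)$.
   Context: Let $\{b_n\}_{n\ge0},\{a_n\}_{n\ge0},\{\lambda_n\}_{n\ge0}$ be sequences of complex numbers. Define monic polynomials $P_n(x)$ by $P_{ -1}(x)=0$, $P_0(x)=1$ and $P_{n+1}(x)=(x-b_n)P_n(x)-(a_nx+\lambda_n)P_{n-1}(x)$ for $n\ge0$. Let $d_0(x)=1$, $d_m(x)=\prod_{i=1}^m(a_ix+\lambda_i)$, and $Q_m(x)=P_m(x)/d_m(x)$. Assume $a_n\neq0$ and $P_n(-\lambda_n/a_n)\neq 0$ for all $n\ge1$. Let $V=\mathrm{span}\{x^nQ_m(x):n,m\ge0\}$ (rational functions), and let $\mathcal{L}$ be the unique linear functional on $V$ with $\mathcal{L}(1)=1$ and $\mathcal{L}(x^nQ_m(x))=0$ whenever $0\le n<m$. A Motzkin–Schröder path is a lattice path never going below the $x$-axis with steps: up $U=(1,1)$, horizontal $H=(1,0)$, vertical down $V=(0,-1)$, diagonal down $D=(1,-1)$. Its weight $\mathrm{wt}(\pi)$ is the product of step weights: each up step has weight $1$; a horizontal step starting at height $k$ has weight $b_k$; a vertical down step starting at height $k$ has weight $a_k$; a diagonal down step starting at height $k$ has weight $\lambda_k$. -}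

module Defs where

open import Level using (Level; _⊔_) renaming (suc to lsuc)
open import Algebra.Bundles using (CommutativeRing)
open import Data.Nat as ℕ using (ℕ; zero; suc; _≤?_; _≟_)
open import Data.Bool using (Bool; true; false; if_then_else_; _∧_)
open import Data.List using (List; []; _∷_; map; foldr; replicate; _++_; concatMap; upTo)
open import Data.Product using (_×_; _,_; proj₁; proj₂)
open import Data.Maybe using (Maybe; just; nothing)
open import Relation.Nullary using (¬_; does)

record Field (c ℓ : Level) : Set (lsuc (c ⊔ ℓ)) where
  field
    commutativeRing : CommutativeRing c ℓ
  open CommutativeRing commutativeRing public
  field
    _⁻¹ : Carrier → Carrier
    ⁻¹-inverse : ∀ x → ¬ (x ≈ 0#) → (x * (x ⁻¹)) ≈ 1#
    1≉0 : ¬ (1# ≈ 0#)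

module MS {c ℓ : Level} (F : Field c ℓ) (b a lam : ℕ → Field.Carrier F) where
  open Field F

  -- Polynomials over F as coefficient lists (constant term first)
  Poly : Set c
  Poly = List Carrier

  infixl 6 _+ₚ_
  infixl 7 _*ₚ_

  _+ₚ_ : Poly → Poly → Poly
  [] +ₚ q = q
  (x ∷ p) +ₚ [] = x ∷ p
  (x ∷ p) +ₚ (y ∷ q) = (x + y) ∷ (p +ₚ q)

  scaleₚ : Carrier → Poly → Poly
  scaleₚ k = map (k *_)

  negₚ : Poly → Poly
  negₚ = map (-_)

  _*ₚ_ : Poly → Poly → Poly
  [] *ₚ q = []
  (x ∷ p) *ₚ q = scaleₚ x q +ₚ (0# ∷ (p *ₚ q))

  xpow : ℕ → Poly → Poly
  xpow n p = replicate n 0# ++ p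

  coeff : Poly → ℕ → Carrier
  coeff [] k = 0#
  coeff (x ∷ p) zero = x
  coeff (x ∷ p) (suc k) = coeff p k

  IsZeroPoly : Poly → Set ℓ
  IsZeroPoly p = ∀ k → coeff p k ≈ 0#

  eval : Poly → Carrier → Carrier
  eval p t = foldr (λ k acc → k + (t * acc)) 0# p

  lin : ℕ → Poly
  lin i = lam i ∷ a i ∷ []

  -- PP n = (P_{n-1} , P_n), with P_{-1} = 0, P_0 = 1
  PP : ℕ → Poly × Poly
  PP zero = [] , (1# ∷ [])
  PP (suc n) = proj₂ (PP n) ,
    ((((- (b n)) ∷ 1# ∷ []) *ₚ proj₂ (PP n)) +ₚ negₚ (lin n *ₚ proj₁ (PP n)))

  P : ℕ → Poly
  P n = proj₂ (PP n)

  -- linProd j k = ∏_{i=j+1}^{k} (a_i x + λ_i)   (= d_k / d_j for j ≤ k)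
  linProd : ℕ → ℕ → Poly
  linProd j zero = 1# ∷ []
  linProd j (suc k) with j ≤? k
  ... | Relation.Nullary.yes _ = linProd j k *ₚ lin (suc k)
  ... | Relation.Nullary.no _ = 1# ∷ []

  -- Elements of V: formal finite linear combinations
  --   Σ c_i x^{n_i} Q_{m_i}(x),   entries (c_i , n_i , m_i)
  Combo : Set c
  Combo = List (Carrier × ℕ × ℕ)

  maxM : Combo → ℕ
  maxM = foldr (λ t acc → proj₂ (proj₂ t) ℕ.⊔ acc) 0

  -- numerator over the common denominator d_M (M = maxM cs):
  --   d_M(x) · Σ c_i x^{n_i} Q_{m_i}(x) = Σ c_i x^{n_i} P_{m_i}(x) d_M(x)/d_{m_i}(x)
  numer : Combo → Poly
  numer cs = foldr (λ t acc → scaleₚ (proj₁ t)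
                 (xpow (proj₁ (proj₂ t)) (P (proj₂ (proj₂ t)) *ₚ linProd (proj₂ (proj₂ t)) (maxM cs)))
                 +ₚ acc) [] cs

  -- the rational function Σ c_i x^{n_i} Q_{m_i} is zero (d_M ≠ 0 as a_i ≠ 0)
  RepresentsZero : Combo → Set ℓ
  RepresentsZero cs = IsZeroPoly (numer cs)

  applyL : (ℕ → ℕ → Carrier) → Combo → Carrier
  applyL Lv cs = foldr (λ t acc → (proj₁ t * Lv (proj₁ (proj₂ t)) (proj₂ (proj₂ t))) + acc) 0# cs

  -- Lv n m = L(x^n Q_m) for a linear functional L on V with L(1) = 1 and
  -- L(x^n Q_m) = 0 for 0 ≤ n < m.  (Lv comes from a well-defined linear
  -- functional on V iff its linear extension kills every combination that
  -- is the zero rational function.)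
  IsFunctionalL : (ℕ → ℕ → Carrier) → Set (c ⊔ ℓ)
  IsFunctionalL Lv =
    (∀ cs → RepresentsZero cs → applyL Lv cs ≈ 0#)
    × (Lv 0 0 ≈ 1#)
    × (∀ n m → n ℕ.< m → Lv n m ≈ 0#)

  data Step : Set where
    U H V D : Step

  allSteps : List Step
  allSteps = U ∷ H ∷ V ∷ D ∷ []

  -- walk h s: follow the steps s starting at height h; returns
  -- (horizontal displacement , final height , weight), or nothing if the
  -- path goes below the x-axis.
  walk : ℕ → List Step → Maybe (ℕ × ℕ × Carrier)
  walk h [] = just (0 , h , 1#)
  walk h (U ∷ s) with walk (suc h) s
  ... | nothing = nothing
  ... | just (x , e , w) = just (suc x , e , (1# * w))
  walk h (H ∷ s) with walk h s
  ... | nothing = nothing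
  ... | just (x , e , w) = just (suc x , e , (b h * w))
  walk zero (V ∷ s) = nothing
  walk (suc h) (V ∷ s) with walk h s
  ... | nothing = nothing
  ... | just (x , e , w) = just (x , e , (a (suc h) * w))
  walk zero (D ∷ s) = nothing
  walk (suc h) (D ∷ s) with walk h s
  ... | nothing = nothing
  ... | just (x , e , w) = just (suc x , e , (lam (suc h) * w))

  words : ℕ → List (List Step)
  words zero = [] ∷ []
  words (suc k) = concatMap (λ w → map (_∷ w) allSteps) (words k)

  contrib : ℕ → ℕ → List Step → Carrier
  contrib n m w with walk 0 w
  ... | nothing = 0#
  ... | just (x , e , wt) = if does (x ≟ n) ∧ does (e ≟ m) then wt else 0#

  sumC : List Carrier → Carrier
  sumC = foldr _+_ 0#

  -- Every path to (n,m) has at most 2n steps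
  -- (n non-vertical steps and at most n vertical ones), so summing over
  -- all words of length ≤ 2n enumerates MS_{n,m} exactly once.
  msSum : ℕ → ℕ → Carrier
  msSum n m = sumC (map (λ k → sumC (map (contrib n m) (words k))) (upTo (suc (n ℕ.+ n))))

-- Both sides satisfy one recurrence that determines them. Dividing the three-term recurrence
-- P_{m+1} = (x − b_m) P_m − (a_m x + λ_m) P_{m−1} by d_{m+1} and multiplying by xⁿ gives
--   x^{n+1} Q_m = xⁿ Q_{m−1} + b_m xⁿ Q_m + a_{m+1} x^{n+1} Q_{m+1} + λ_{m+1} xⁿ Q_{m+1}   in V,
-- so L(xⁿQ_m) obeys this recurrence. Sorting the paths that end at (n+1, m) by their last step
-- (U from (n, m−1), H from (n, m), V from (n+1, m+1), D from (n, m+1)) shows that the path sums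
-- obey it too. Both tables are 1 at the origin and vanish for n < m, and these data fix a table:
-- by induction on n, and within row n+1 by downward induction on m from where it vanishes.

module Submission where

open import Defs
open import Level using (Level; _⊔_)
open import Algebra.Bundles using (CommutativeRing)
open import Data.Bool using (if_then_else_; _∧_)
open import Data.Empty using (⊥; ⊥-elim)
open import Data.List using (List; []; _∷_; _++_; length; foldl; foldr; map; concatMap; upTo; applyUpTo)
import Data.List.Properties as LP
import Algebra.Properties.Ring
open import Data.Maybe using (Maybe; just; nothing)
open import Data.Maybe.Relation.Binary.Pointwise as Maybeₚ using (just; nothing)
open import Data.Nat as ℕ using (ℕ; zero; suc; _≤_; _<_; _≤?_; _≟_; z≤n; s≤s)
import Data.Nat.Properties as ℕₚ
open import Data.Nat.Tactic.RingSolver using (solve-∀)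
open import Data.Product using (_×_; _,_; proj₁; proj₂)
open import Data.Product.Relation.Binary.Pointwise.NonDependent using (×-setoid)
open import Data.Unit using (⊤)
open import Function using (_∘_)
open import Relation.Binary.Bundles using (Setoid)
import Relation.Binary.PropositionalEquality as ≡
open ≡ using (_≡_)
open import Relation.Nullary using (¬_; Dec; yes; no; does)

module _ {r ℓr : Level} (R : CommutativeRing r ℓr) where
  open CommutativeRing R
  open import Algebra.Solver.Ring.NaturalCoefficients.Default commutativeSemiring
  open import Relation.Binary.Reasoning.Setoid setoid

  -- With X = x, Y = xⁿ, B = b_m, A = a_{m+1}, Λ = λ_{m+1}, ℓ′ = a_{m+1} x + λ_{m+1},
  -- W = (a_m x + λ_m) P_{m−1}, Pm = P_m, Pm′ = P_{m+1}, the second hypothesis is the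
  -- three-term recurrence, and the identity says that the numerators over d_{m+1} of
  -- xⁿQ_{m−1}, b_m xⁿQ_m, a_{m+1} x^{n+1}Q_{m+1} and λ_{m+1} xⁿQ_{m+1} add up to that of x^{n+1}Q_m.
  last-step-identity : ∀ X Y B A Λ ℓ′ W Pm Pm′ →
    ℓ′ ≈ Λ + X * A → B * Pm + (W + Pm′) ≈ X * Pm →
    Y * (W * ℓ′) + (B * (Y * (Pm * ℓ′)) + (A * ((X * Y) * Pm′) + (Λ * (Y * Pm′) + 0#)))
      ≈ (X * Y) * (Pm * ℓ′)
  last-step-identity X Y B A Λ ℓ′ W Pm Pm′ ℓ′≈ rec = begin
    Y * (W * ℓ′) + (B * (Y * (Pm * ℓ′)) + (A * ((X * Y) * Pm′) + (Λ * (Y * Pm′) + 0#)))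
      ≈⟨ solve 9 (λ X Y B A Λ ℓ′ W Pm Pm′ →
           Y :* (W :* ℓ′) :+ (B :* (Y :* (Pm :* ℓ′)) :+ (A :* ((X :* Y) :* Pm′) :+ (Λ :* (Y :* Pm′) :+ con 0)))
           := Y :* (ℓ′ :* (B :* Pm :+ W)) :+ Y :* ((Λ :+ X :* A) :* Pm′)) refl X Y B A Λ ℓ′ W Pm Pm′ ⟩
    Y * (ℓ′ * (B * Pm + W)) + Y * ((Λ + X * A) * Pm′)
      ≈⟨ +-congˡ (*-congˡ (*-congʳ (sym ℓ′≈))) ⟩
    Y * (ℓ′ * (B * Pm + W)) + Y * (ℓ′ * Pm′)
      ≈⟨ solve 6 (λ Y B ℓ′ W Pm Pm′ →
           Y :* (ℓ′ :* (B :* Pm :+ W)) :+ Y :* (ℓ′ :* Pm′) := (Y :* ℓ′) :* (B :* Pm :+ (W :+ Pm′)))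
           refl Y B ℓ′ W Pm Pm′ ⟩
    (Y * ℓ′) * (B * Pm + (W + Pm′))
      ≈⟨ *-congˡ rec ⟩
    (Y * ℓ′) * (X * Pm)
      ≈⟨ solve 4 (λ X Y ℓ′ Pm → (Y :* ℓ′) :* (X :* Pm) := (X :* Y) :* (Pm :* ℓ′)) refl X Y ℓ′ Pm ⟩
    (X * Y) * (Pm * ℓ′)
      ∎

module Polynomial {c ℓ : Level} (F : Field c ℓ) (b a lam : ℕ → Field.Carrier F) where
  open Field F hiding (zero)
  open MS F b a lam
  open import Algebra.Properties.Ring ring using (-0#≈0#)
  open import Algebra.Solver.Ring.NaturalCoefficients.Default commutativeSemiring
  open import Relation.Binary.Reasoning.Setoid setoid

  infix 4 _≋_
  record _≋_ (p q : Poly) : Set ℓ where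
    constructor coeffwise
    field coeff-≈ : ∀ k → coeff p k ≈ coeff q k
  open _≋_ public

  ≋-refl : ∀ {p} → p ≋ p
  ≋-refl = coeffwise λ _ → refl

  ≋-sym : ∀ {p q} → p ≋ q → q ≋ p
  ≋-sym e = coeffwise λ k → sym (coeff-≈ e k)

  ≋-trans : ∀ {p q r} → p ≋ q → q ≋ r → p ≋ r
  ≋-trans e f = coeffwise λ k → trans (coeff-≈ e k) (coeff-≈ f k)

  ∷-cong : ∀ {x y p q} → x ≈ y → p ≋ q → (x ∷ p) ≋ (y ∷ q)
  ∷-cong e f = coeffwise λ { zero → e ; (suc k) → coeff-≈ f k }

  coeff-0∷[] : ∀ k → coeff (0# ∷ []) k ≈ 0#
  coeff-0∷[] zero = refl
  coeff-0∷[] (suc k) = refl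

  coeff-+ₚ : ∀ p q k → coeff (p +ₚ q) k ≈ coeff p k + coeff q k
  coeff-+ₚ [] q k = sym (+-identityˡ _)
  coeff-+ₚ (x ∷ p) [] k = sym (+-identityʳ _)
  coeff-+ₚ (x ∷ p) (y ∷ q) zero = refl
  coeff-+ₚ (x ∷ p) (y ∷ q) (suc k) = coeff-+ₚ p q k

  coeff-scaleₚ : ∀ x p k → coeff (scaleₚ x p) k ≈ x * coeff p k
  coeff-scaleₚ x [] k = sym (zeroʳ _)
  coeff-scaleₚ x (y ∷ p) zero = refl
  coeff-scaleₚ x (y ∷ p) (suc k) = coeff-scaleₚ x p k

  coeff-negₚ : ∀ p k → coeff (negₚ p) k ≈ - coeff p k
  coeff-negₚ [] k = sym -0#≈0#
  coeff-negₚ (y ∷ p) zero = refl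
  coeff-negₚ (y ∷ p) (suc k) = coeff-negₚ p k

  0∷-+ₚ : ∀ p q → (0# ∷ (p +ₚ q)) ≋ ((0# ∷ p) +ₚ (0# ∷ q))
  0∷-+ₚ p q = coeffwise λ { zero → sym (+-identityˡ 0#) ; (suc k) → refl }

  coeff-∷*ₚ : ∀ x p q k → coeff ((x ∷ p) *ₚ q) k ≈ x * coeff q k + coeff (0# ∷ (p *ₚ q)) k
  coeff-∷*ₚ x p q k = trans (coeff-+ₚ (scaleₚ x q) (0# ∷ (p *ₚ q)) k) (+-congʳ (coeff-scaleₚ x q k))

  +ₚ-cong : ∀ {p p′ q q′} → p ≋ p′ → q ≋ q′ → (p +ₚ q) ≋ (p′ +ₚ q′)
  +ₚ-cong {p} {p′} {q} {q′} e f = coeffwise λ k → begin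
    coeff (p +ₚ q) k          ≈⟨ coeff-+ₚ p q k ⟩
    coeff p k + coeff q k     ≈⟨ +-cong (coeff-≈ e k) (coeff-≈ f k) ⟩
    coeff p′ k + coeff q′ k   ≈⟨ coeff-+ₚ p′ q′ k ⟨
    coeff (p′ +ₚ q′) k        ∎

  +ₚ-assoc : ∀ p q r → ((p +ₚ q) +ₚ r) ≋ (p +ₚ (q +ₚ r))
  +ₚ-assoc p q r = coeffwise λ k → begin
    coeff ((p +ₚ q) +ₚ r) k                 ≈⟨ trans (coeff-+ₚ (p +ₚ q) r k) (+-congʳ (coeff-+ₚ p q k)) ⟩
    (coeff p k + coeff q k) + coeff r k     ≈⟨ +-assoc _ _ _ ⟩
    coeff p k + (coeff q k + coeff r k)     ≈⟨ trans (coeff-+ₚ p (q +ₚ r) k) (+-congˡ (coeff-+ₚ q r k)) ⟨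
    coeff (p +ₚ (q +ₚ r)) k                 ∎

  +ₚ-comm : ∀ p q → (p +ₚ q) ≋ (q +ₚ p)
  +ₚ-comm p q = coeffwise λ k → trans (coeff-+ₚ p q k) (trans (+-comm _ _) (sym (coeff-+ₚ q p k)))

  +ₚ-identityˡ : ∀ p → ([] +ₚ p) ≋ p
  +ₚ-identityˡ p = ≋-refl

  negₚ-cong : ∀ {p q} → p ≋ q → negₚ p ≋ negₚ q
  negₚ-cong {p} {q} e = coeffwise λ k →
    trans (coeff-negₚ p k) (trans (-‿cong (coeff-≈ e k)) (sym (coeff-negₚ q k)))

  negₚ-inverseˡ : ∀ p → (negₚ p +ₚ p) ≋ []
  negₚ-inverseˡ p = coeffwise λ k →
    trans (coeff-+ₚ (negₚ p) p k) (trans (+-congʳ (coeff-negₚ p k)) (-‿inverseˡ _))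

  *ₚ-congʳ : ∀ p {q q′} → q ≋ q′ → (p *ₚ q) ≋ (p *ₚ q′)
  *ₚ-congʳ [] e = ≋-refl
  *ₚ-congʳ (x ∷ p) {q} {q′} e = coeffwise λ k → begin
    coeff ((x ∷ p) *ₚ q) k                        ≈⟨ coeff-∷*ₚ x p q k ⟩
    x * coeff q k + coeff (0# ∷ (p *ₚ q)) k
      ≈⟨ +-cong (*-congˡ (coeff-≈ e k)) (coeff-≈ (∷-cong refl (*ₚ-congʳ p e)) k) ⟩
    x * coeff q′ k + coeff (0# ∷ (p *ₚ q′)) k     ≈⟨ coeff-∷*ₚ x p q′ k ⟨
    coeff ((x ∷ p) *ₚ q′) k                       ∎

  *ₚ-identityˡ : ∀ p → ((1# ∷ []) *ₚ p) ≋ p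
  *ₚ-identityˡ p = coeffwise λ k → begin
    coeff ((1# ∷ []) *ₚ p) k                ≈⟨ coeff-∷*ₚ 1# [] p k ⟩
    1# * coeff p k + coeff (0# ∷ []) k      ≈⟨ +-cong (*-identityˡ _) (coeff-0∷[] k) ⟩
    coeff p k + 0#                          ≈⟨ +-identityʳ _ ⟩
    coeff p k                               ∎

  *ₚ-distribʳ : ∀ q p p′ → ((p +ₚ p′) *ₚ q) ≋ ((p *ₚ q) +ₚ (p′ *ₚ q))
  *ₚ-distribʳ q [] p′ = ≋-refl
  *ₚ-distribʳ q (x ∷ p) [] = ≋-sym (coeffwise λ k → trans (coeff-+ₚ ((x ∷ p) *ₚ q) [] k) (+-identityʳ _))
  *ₚ-distribʳ q (x ∷ p) (x′ ∷ p′) = coeffwise λ k → begin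
    coeff (((x + x′) ∷ (p +ₚ p′)) *ₚ q) k
      ≈⟨ coeff-∷*ₚ (x + x′) (p +ₚ p′) q k ⟩
    (x + x′) * coeff q k + coeff (0# ∷ ((p +ₚ p′) *ₚ q)) k
      ≈⟨ +-congˡ (coeff-≈ (≋-trans (∷-cong refl (*ₚ-distribʳ q p p′)) (0∷-+ₚ (p *ₚ q) (p′ *ₚ q))) k) ⟩
    (x + x′) * coeff q k + coeff ((0# ∷ (p *ₚ q)) +ₚ (0# ∷ (p′ *ₚ q))) k
      ≈⟨ +-congˡ (coeff-+ₚ (0# ∷ (p *ₚ q)) (0# ∷ (p′ *ₚ q)) k) ⟩
    (x + x′) * coeff q k + (coeff (0# ∷ (p *ₚ q)) k + coeff (0# ∷ (p′ *ₚ q)) k)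
      ≈⟨ solve 5 (λ x x′ c s s′ → (x :+ x′) :* c :+ (s :+ s′) := (x :* c :+ s) :+ (x′ :* c :+ s′))
           refl x x′ _ _ _ ⟩
    (x * coeff q k + coeff (0# ∷ (p *ₚ q)) k) + (x′ * coeff q k + coeff (0# ∷ (p′ *ₚ q)) k)
      ≈⟨ trans (coeff-+ₚ ((x ∷ p) *ₚ q) ((x′ ∷ p′) *ₚ q) k)
           (+-cong (coeff-∷*ₚ x p q k) (coeff-∷*ₚ x′ p′ q k)) ⟨
    coeff (((x ∷ p) *ₚ q) +ₚ ((x′ ∷ p′) *ₚ q)) k
      ∎

  scaleₚ-*ₚ : ∀ x q r → (scaleₚ x q *ₚ r) ≋ scaleₚ x (q *ₚ r)
  scaleₚ-*ₚ x [] r = ≋-refl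
  scaleₚ-*ₚ x (y ∷ q) r = coeffwise λ k → begin
    coeff (((x * y) ∷ scaleₚ x q) *ₚ r) k
      ≈⟨ coeff-∷*ₚ (x * y) (scaleₚ x q) r k ⟩
    (x * y) * coeff r k + coeff (0# ∷ (scaleₚ x q *ₚ r)) k
      ≈⟨ +-congˡ (coeff-≈ (∷-cong (sym (zeroʳ x)) (scaleₚ-*ₚ x q r)) k) ⟩
    (x * y) * coeff r k + coeff (scaleₚ x (0# ∷ (q *ₚ r))) k
      ≈⟨ +-congˡ (coeff-scaleₚ x (0# ∷ (q *ₚ r)) k) ⟩
    (x * y) * coeff r k + x * coeff (0# ∷ (q *ₚ r)) k
      ≈⟨ solve 4 (λ x y c s → (x :* y) :* c :+ x :* s := x :* (y :* c :+ s)) refl x y _ _ ⟩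
    x * (y * coeff r k + coeff (0# ∷ (q *ₚ r)) k)
      ≈⟨ trans (coeff-scaleₚ x ((y ∷ q) *ₚ r) k) (*-congˡ (coeff-∷*ₚ y q r k)) ⟨
    coeff (scaleₚ x ((y ∷ q) *ₚ r)) k
      ∎

  0∷-*ₚ : ∀ p q → ((0# ∷ p) *ₚ q) ≋ (0# ∷ (p *ₚ q))
  0∷-*ₚ p q = coeffwise λ k → trans (coeff-∷*ₚ 0# p q k) (trans (+-congʳ (zeroˡ _)) (+-identityˡ _))

  *ₚ-assoc : ∀ p q r → ((p *ₚ q) *ₚ r) ≋ (p *ₚ (q *ₚ r))
  *ₚ-assoc [] q r = ≋-refl
  *ₚ-assoc (x ∷ p) q r =
    ≋-trans (*ₚ-distribʳ r (scaleₚ x q) (0# ∷ (p *ₚ q)))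
      (+ₚ-cong (scaleₚ-*ₚ x q r) (≋-trans (0∷-*ₚ (p *ₚ q) r) (∷-cong refl (*ₚ-assoc p q r))))

  *ₚ-zeroʳ : ∀ p → (p *ₚ []) ≋ []
  *ₚ-zeroʳ [] = ≋-refl
  *ₚ-zeroʳ (x ∷ p) = coeffwise λ { zero → refl ; (suc k) → coeff-≈ (*ₚ-zeroʳ p) k }

  *ₚ-∷ʳ : ∀ p y q → (p *ₚ (y ∷ q)) ≋ (scaleₚ y p +ₚ (0# ∷ (p *ₚ q)))
  *ₚ-∷ʳ [] y q = coeffwise (sym ∘ coeff-0∷[])
  *ₚ-∷ʳ (x ∷ p) y q = coeffwise λ
    { zero → trans (+-identityʳ _) (trans (*-comm x y) (sym (+-identityʳ _)))
    ; (suc k) → begin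
        coeff (scaleₚ x q +ₚ (p *ₚ (y ∷ q))) k
          ≈⟨ coeff-+ₚ (scaleₚ x q) (p *ₚ (y ∷ q)) k ⟩
        coeff (scaleₚ x q) k + coeff (p *ₚ (y ∷ q)) k
          ≈⟨ +-cong (coeff-scaleₚ x q k) (coeff-≈ (*ₚ-∷ʳ p y q) k) ⟩
        x * coeff q k + coeff (scaleₚ y p +ₚ (0# ∷ (p *ₚ q))) k
          ≈⟨ +-congˡ (trans (coeff-+ₚ (scaleₚ y p) (0# ∷ (p *ₚ q)) k) (+-congʳ (coeff-scaleₚ y p k))) ⟩
        x * coeff q k + (y * coeff p k + coeff (0# ∷ (p *ₚ q)) k)
          ≈⟨ solve 3 (λ u v s → u :+ (v :+ s) := v :+ (u :+ s)) refl _ _ _ ⟩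
        y * coeff p k + (x * coeff q k + coeff (0# ∷ (p *ₚ q)) k)
          ≈⟨ +-cong (coeff-scaleₚ y p k) (coeff-∷*ₚ x p q k) ⟨
        coeff (scaleₚ y p) k + coeff ((x ∷ p) *ₚ q) k
          ≈⟨ coeff-+ₚ (scaleₚ y (x ∷ p)) (0# ∷ ((x ∷ p) *ₚ q)) (suc k) ⟨
        coeff (scaleₚ y (x ∷ p) +ₚ (0# ∷ ((x ∷ p) *ₚ q))) (suc k)
          ∎ }

  *ₚ-comm : ∀ p q → (p *ₚ q) ≋ (q *ₚ p)
  *ₚ-comm [] q = ≋-sym (*ₚ-zeroʳ q)
  *ₚ-comm (x ∷ p) q = ≋-trans (+ₚ-cong ≋-refl (∷-cong refl (*ₚ-comm p q))) (≋-sym (*ₚ-∷ʳ q x p))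

  ≋-setoid : Setoid c ℓ
  ≋-setoid = record
    { Carrier = Poly ; _≈_ = _≋_
    ; isEquivalence = record { refl = ≋-refl ; sym = ≋-sym ; trans = ≋-trans } }

  polyRing : CommutativeRing c ℓ
  polyRing = record
    { Carrier = Poly ; _≈_ = _≋_ ; _+_ = _+ₚ_ ; _*_ = _*ₚ_ ; -_ = negₚ ; 0# = [] ; 1# = 1# ∷ []
    ; isCommutativeRing = record
      { isRing = record
        { +-isAbelianGroup = record
          { isGroup = record
            { isMonoid = record
              { isSemigroup = record
                { isMagma = record { isEquivalence = Setoid.isEquivalence ≋-setoid ; ∙-cong = +ₚ-cong }
                ; assoc = +ₚ-assoc }
              ; identity = comm∧idˡ⇒id +ₚ-comm +ₚ-identityˡ }
            ; inverse = comm∧invˡ⇒inv +ₚ-comm negₚ-inverseˡ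
            ; ⁻¹-cong = negₚ-cong }
          ; comm = +ₚ-comm }
        ; *-cong = *ₚ-cong
        ; *-assoc = *ₚ-assoc
        ; *-identity = comm∧idˡ⇒id *ₚ-comm *ₚ-identityˡ
        ; distrib = comm∧distrʳ⇒distr +ₚ-cong *ₚ-comm *ₚ-distribʳ }
      ; *-comm = *ₚ-comm } }
    where
    open import Algebra.Consequences.Setoid ≋-setoid
    *ₚ-cong : ∀ {p p′ q q′} → p ≋ p′ → q ≋ q′ → (p *ₚ q) ≋ (p′ *ₚ q′)
    *ₚ-cong {p} {p′} {q} {q′} e f =
      ≋-trans (*ₚ-comm p q) (≋-trans (*ₚ-congʳ q e) (≋-trans (*ₚ-comm q p′) (*ₚ-congʳ p′ f)))

  module ℙ = CommutativeRing polyRing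

module ThreeTermRecurrence {c ℓ : Level} (F : Field c ℓ) (b a lam : ℕ → Field.Carrier F) where
  open Field F hiding (zero)
  open MS F b a lam
  open Polynomial F b a lam
  open import Relation.Binary.Reasoning.Setoid ≋-setoid

  X : Poly
  X = 0# ∷ 1# ∷ []

  [_] : Carrier → Poly
  [ x ] = x ∷ []

  Xⁿ : ℕ → Poly
  Xⁿ n = xpow n [ 1# ]

  const*ₚ≋scaleₚ : ∀ x p → ([ x ] *ₚ p) ≋ scaleₚ x p
  const*ₚ≋scaleₚ x p = coeffwise λ k →
    trans (coeff-+ₚ (scaleₚ x p) (0# ∷ []) k) (trans (+-congˡ (coeff-0∷[] k)) (+-identityʳ _))

  X*ₚ : ∀ p → (X *ₚ p) ≋ (0# ∷ p)
  X*ₚ p = begin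
    X *ₚ p                            ≈⟨ 0∷-*ₚ [ 1# ] p ⟩
    0# ∷ ([ 1# ] *ₚ p)                ≈⟨ ∷-cong refl (ℙ.*-identityˡ p) ⟩
    0# ∷ p                            ∎

  xpow≋Xⁿ*ₚ : ∀ n p → xpow n p ≋ (Xⁿ n *ₚ p)
  xpow≋Xⁿ*ₚ zero p = ℙ.sym (ℙ.*-identityˡ p)
  xpow≋Xⁿ*ₚ (suc n) p = ≋-trans (∷-cong refl (xpow≋Xⁿ*ₚ n p)) (≋-sym (0∷-*ₚ (Xⁿ n) p))

  Xⁿ-suc : ∀ n → Xⁿ (suc n) ≋ (X *ₚ Xⁿ n)
  Xⁿ-suc n = ≋-sym (X*ₚ (Xⁿ n))

  lin≋ : ∀ i → lin i ≋ ([ lam i ] +ₚ (X *ₚ [ a i ]))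
  lin≋ i = ≋-sym (≋-trans (+ₚ-cong (≋-refl {[ lam i ]}) (X*ₚ [ a i ])) (∷-cong (+-identityʳ _) ≋-refl))

  three-term-recurrence : ∀ m →
    (([ b m ] *ₚ P m) +ₚ ((lin m *ₚ proj₁ (PP m)) +ₚ P (suc m))) ≋ (X *ₚ P m)
  three-term-recurrence m = begin
    B *ₚ P m +ₚ (L +ₚ (S *ₚ P m +ₚ negₚ L))   ≈⟨ +ₚ-cong (≋-refl {B *ₚ P m}) (ℙ.sym (ℙ.+-assoc L _ _)) ⟩
    B *ₚ P m +ₚ ((L +ₚ S *ₚ P m) +ₚ negₚ L)   ≈⟨ +ₚ-cong (≋-refl {B *ₚ P m}) (xyx⁻¹≈y L (S *ₚ P m)) ⟩
    B *ₚ P m +ₚ S *ₚ P m                      ≈⟨ ℙ.distribʳ (P m) B S ⟨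
    (B +ₚ S) *ₚ P m                           ≈⟨ ℙ.*-congʳ {P m} (∷-cong (-‿inverseʳ (b m)) (≋-refl {1# ∷ []})) ⟩
    X *ₚ P m                                  ∎
    where
    open import Algebra.Properties.Ring ℙ.ring using (xyx⁻¹≈y)
    B L S : Poly
    B = [ b m ]
    L = lin m *ₚ proj₁ (PP m)
    S = (- b m) ∷ 1# ∷ []

  linProd-refl : ∀ j → linProd j j ≡ [ 1# ]
  linProd-refl zero = ≡.refl
  linProd-refl (suc j) with suc j ≤? j
  ... | yes j<j = ⊥-elim (ℕₚ.<-irrefl ≡.refl j<j)
  ... | no _ = ≡.refl

  linProd-step : ∀ {j k} → j ≤ k → linProd j (suc k) ≡ linProd j k *ₚ lin (suc k)
  linProd-step {j} {k} j≤k with j ≤? k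
  ... | yes _ = ≡.refl
  ... | no j≰k = ⊥-elim (j≰k j≤k)

  linProd-next : ∀ j → linProd j (suc j) ≋ lin (suc j)
  linProd-next j = begin
    linProd j (suc j)             ≡⟨ linProd-step {j} ℕₚ.≤-refl ⟩
    linProd j j *ₚ lin (suc j)    ≡⟨ ≡.cong (_*ₚ lin (suc j)) (linProd-refl j) ⟩
    [ 1# ] *ₚ lin (suc j)         ≈⟨ ℙ.*-identityˡ _ ⟩
    lin (suc j)                   ∎

  linProd-next₂ : ∀ j → linProd j (suc (suc j)) ≋ (lin (suc j) *ₚ lin (suc (suc j)))
  linProd-next₂ j = begin
    linProd j (suc (suc j))                 ≡⟨ linProd-step {j} (ℕₚ.n≤1+n j) ⟩
    linProd j (suc j) *ₚ lin (suc (suc j))  ≈⟨ ℙ.*-congʳ {lin (suc (suc j))} (linProd-next j) ⟩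
    lin (suc j) *ₚ lin (suc (suc j))        ∎

module LastStep {c ℓ : Level} (F : Field c ℓ) (b a lam : ℕ → Field.Carrier F) where
  open Field F

  Table : Set c
  Table = ℕ → ℕ → Carrier

  viaUp : Table → ℕ → ℕ → Carrier
  viaUp T n zero = 0#
  viaUp T n (suc m) = T n m

  viaLastStep : Table → ℕ → ℕ → Carrier
  viaLastStep T n m =
    viaUp T n m + (b m * T n m + (a (suc m) * T (suc n) (suc m) + lam (suc m) * T n (suc m)))

  record LastStepRecurrence (T : Table) : Set ℓ where
    field
      at-origin : T 0 0 ≈ 1#
      above-diagonal : ∀ {n m} → n < m → T n m ≈ 0#
      last-step : ∀ n m → T (suc n) m ≈ viaLastStep T n m

  viaUp-cong : ∀ {T T′ : Table} {n} → (∀ k → T n k ≈ T′ n k) → ∀ m → viaUp T n m ≈ viaUp T′ n m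
  viaUp-cong row zero = refl
  viaUp-cong row (suc m) = row m

  viaLastStep-cong : ∀ {T T′ : Table} {n m} → (∀ k → T n k ≈ T′ n k) →
    T (suc n) (suc m) ≈ T′ (suc n) (suc m) → viaLastStep T n m ≈ viaLastStep T′ n m
  viaLastStep-cong {m = m} row next = +-cong (viaUp-cong row m)
    (+-cong (*-congˡ (row m)) (+-cong (*-congˡ next) (*-congˡ (row (suc m)))))

  lastStep-unique : ∀ {T T′ : Table} → LastStepRecurrence T → LastStepRecurrence T′ →
    ∀ n m → T n m ≈ T′ n m
  lastStep-unique {T} {T′} rec rec′ = row
    where
    module R = LastStepRecurrence rec
    module R′ = LastStepRecurrence rec′

    both-vanish : ∀ {n m} → n < m → T n m ≈ T′ n m
    both-vanish n<m = trans (R.above-diagonal n<m) (sym (R′.above-diagonal n<m))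

    row : ∀ n m → T n m ≈ T′ n m
    row zero zero = trans R.at-origin (sym R′.at-origin)
    row zero (suc m) = both-vanish (s≤s z≤n)
    row (suc n) m = downwards (suc (suc n)) m (ℕₚ.m≤n+m (suc (suc n)) m)
      where
      -- downward induction on m, starting where T (suc n) m vanishes
      downwards : ∀ t m → suc n < m ℕ.+ t → T (suc n) m ≈ T′ (suc n) m
      downwards zero m lt = both-vanish (≡.subst (suc n <_) (ℕₚ.+-identityʳ m) lt)
      downwards (suc t) m lt = begin
        T (suc n) m             ≈⟨ R.last-step n m ⟩
        viaLastStep T n m       ≈⟨ viaLastStep-cong (row n) (downwards t (suc m) lt′) ⟩
        viaLastStep T′ n m      ≈⟨ R′.last-step n m ⟨
        T′ (suc n) m            ∎
        where
        open import Relation.Binary.Reasoning.Setoid setoid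
        lt′ : suc n < suc m ℕ.+ t
        lt′ = ≡.subst (suc n <_) (ℕₚ.+-suc m t) lt

module Moments {c ℓ : Level} (F : Field c ℓ) (b a lam : ℕ → Field.Carrier F) where
  open Field F hiding (zero)
  open MS F b a lam
  open Polynomial F b a lam
  open ThreeTermRecurrence F b a lam
  open LastStep F b a lam
  open import Algebra.Properties.Ring ring using (-0#≈0#; -‿distribˡ-*; -‿+-comm; x∙y⁻¹≈ε⇒x≈y)

  -- numer cs is numerWith (maxM cs) cs by definition.
  numerWith : ℕ → Combo → Poly
  numerWith M = foldr (λ t acc → scaleₚ (proj₁ t)
                  (xpow (proj₁ (proj₂ t)) (P (proj₂ (proj₂ t)) *ₚ linProd (proj₂ (proj₂ t)) M))
                  +ₚ acc) []

  negateCoeffs : Combo → Combo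
  negateCoeffs = map (λ t → (- proj₁ t , proj₂ t))

  applyL-negateCoeffs : ∀ Lv cs → applyL Lv (negateCoeffs cs) ≈ - applyL Lv cs
  applyL-negateCoeffs Lv [] = sym -0#≈0#
  applyL-negateCoeffs Lv ((x , n , m) ∷ cs) =
    trans (+-cong (sym (-‿distribˡ-* x (Lv n m))) (applyL-negateCoeffs Lv cs)) (-‿+-comm _ _)

  numerWith-negateCoeffs : ∀ M cs → numerWith M (negateCoeffs cs) ≋ negₚ (numerWith M cs)
  numerWith-negateCoeffs M [] = ≋-refl
  numerWith-negateCoeffs M ((x , n , m) ∷ cs) =
    ≋-trans (+ₚ-cong scaleₚ-neg (numerWith-negateCoeffs M cs)) (ℙ-props.-‿+-comm (scaleₚ x q) (numerWith M cs))
    where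
    module ℙ-props = Algebra.Properties.Ring ℙ.ring
    q : Poly
    q = xpow n (P m *ₚ linProd m M)
    scaleₚ-neg : scaleₚ (- x) q ≋ negₚ (scaleₚ x q)
    scaleₚ-neg = coeffwise λ k → begin
      coeff (scaleₚ (- x) q) k   ≈⟨ coeff-scaleₚ (- x) q k ⟩
      - x * coeff q k            ≈⟨ -‿distribˡ-* x (coeff q k) ⟨
      - (x * coeff q k)          ≈⟨ -‿cong (coeff-scaleₚ x q k) ⟨
      - coeff (scaleₚ x q) k     ≈⟨ coeff-negₚ (scaleₚ x q) k ⟨
      coeff (negₚ (scaleₚ x q)) k ∎
      where open import Relation.Binary.Reasoning.Setoid setoid

  nonUpTerms : ℕ → ℕ → Combo
  nonUpTerms n m = (b m , n , m) ∷ (a (suc m) , suc n , suc m) ∷ (lam (suc m) , n , suc m) ∷ []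

  lastStepTerms : ℕ → ℕ → Combo
  lastStepTerms n zero = nonUpTerms n zero
  lastStepTerms n (suc j) = (1# , n , j) ∷ nonUpTerms n (suc j)

  lastStepCombo : ℕ → ℕ → Combo
  lastStepCombo n m = (1# , suc n , m) ∷ negateCoeffs (lastStepTerms n m)

  applyL-lastStepTerms : ∀ Lv n m → applyL Lv (lastStepTerms n m) ≈ viaLastStep Lv n m
  applyL-lastStepTerms Lv n zero = trans (+-congˡ (+-congˡ (+-identityʳ _))) (sym (+-identityˡ _))
  applyL-lastStepTerms Lv n (suc j) = +-cong (*-identityˡ _) (+-congˡ (+-congˡ (+-identityʳ _)))

  applyL-lastStepCombo : ∀ Lv n m → applyL Lv (lastStepCombo n m) ≈ Lv (suc n) m + - viaLastStep Lv n m
  applyL-lastStepCombo Lv n m = +-cong (*-identityˡ _)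
    (trans (applyL-negateCoeffs Lv (lastStepTerms n m)) (-‿cong (applyL-lastStepTerms Lv n m)))

  maxM-lastStepCombo : ∀ n m → maxM (lastStepCombo n m) ≡ suc m
  maxM-lastStepCombo n zero = ≡.refl
  maxM-lastStepCombo n (suc zero) = ≡.refl
  maxM-lastStepCombo n (suc (suc j)) = ≡.cong suc (maxM-lastStepCombo n (suc j))

  scaleₚ-xpow : ∀ x n q → scaleₚ x (xpow n q) ≋ ([ x ] *ₚ (Xⁿ n *ₚ q))
  scaleₚ-xpow x n q = ≋-trans (≋-sym (const*ₚ≋scaleₚ x (xpow n q))) (*ₚ-congʳ [ x ] (xpow≋Xⁿ*ₚ n q))

  *ₚ-linProd-refl : ∀ q m → (q *ₚ linProd m m) ≋ q
  *ₚ-linProd-refl q m = ≋-trans (ℙ.reflexive (≡.cong (q *ₚ_) (linProd-refl m))) (ℙ.*-identityʳ q)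

  numerWith-nonUpTerms : ∀ n m → numerWith (suc m) (nonUpTerms n m) ≋
    ([ b m ] *ₚ (Xⁿ n *ₚ (P m *ₚ lin (suc m)))
      +ₚ ([ a (suc m) ] *ₚ ((X *ₚ Xⁿ n) *ₚ P (suc m))
      +ₚ ([ lam (suc m) ] *ₚ (Xⁿ n *ₚ P (suc m)) +ₚ [])))
  numerWith-nonUpTerms n m =
    +ₚ-cong (≋-trans (scaleₚ-xpow (b m) n _)
              (*ₚ-congʳ [ b m ] (*ₚ-congʳ (Xⁿ n) (*ₚ-congʳ (P m) (linProd-next m)))))
   (+ₚ-cong (≋-trans (scaleₚ-xpow (a (suc m)) (suc n) _)
              (*ₚ-congʳ [ a (suc m) ] (ℙ.*-cong (Xⁿ-suc n) (*ₚ-linProd-refl (P (suc m)) (suc m)))))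
   (+ₚ-cong (≋-trans (scaleₚ-xpow (lam (suc m)) n _)
              (*ₚ-congʳ [ lam (suc m) ] (*ₚ-congʳ (Xⁿ n) (*ₚ-linProd-refl (P (suc m)) (suc m)))))
     (≋-refl {[]})))

  numerWith-lastStepTerms≋up+nonUp : ∀ n m → numerWith (suc m) (lastStepTerms n m) ≋
    ((Xⁿ n *ₚ ((lin m *ₚ proj₁ (PP m)) *ₚ lin (suc m))) +ₚ numerWith (suc m) (nonUpTerms n m))
  numerWith-lastStepTerms≋up+nonUp n zero = ≋-sym (+ₚ-cong no-up-term (≋-refl {numerWith 1 (nonUpTerms n zero)}))
    where
    no-up-term : (Xⁿ n *ₚ ((lin 0 *ₚ []) *ₚ lin 1)) ≋ []
    no-up-term = ≋-trans (*ₚ-congʳ (Xⁿ n) (≋-trans (ℙ.*-congʳ {lin 1} (ℙ.zeroʳ (lin 0))) (ℙ.zeroˡ (lin 1))))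
                   (ℙ.zeroʳ (Xⁿ n))
  numerWith-lastStepTerms≋up+nonUp n (suc j) = +ₚ-cong up-term (≋-refl {numerWith (suc (suc j)) (nonUpTerms n (suc j))})
    where
    open import Algebra.Solver.Ring.NaturalCoefficients.Default ℙ.commutativeSemiring
    up-term : scaleₚ 1# (xpow n (P j *ₚ linProd j (suc (suc j)))) ≋
              (Xⁿ n *ₚ ((lin (suc j) *ₚ P j) *ₚ lin (suc (suc j))))
    up-term = ≋-trans (scaleₚ-xpow 1# n _) (≋-trans (ℙ.*-identityˡ _)
      (*ₚ-congʳ (Xⁿ n) (≋-trans (*ₚ-congʳ (P j) (linProd-next₂ j))
        (solve 3 (λ p ℓ ℓ′ → p :* (ℓ :* ℓ′) := (ℓ :* p) :* ℓ′)
           ℙ.refl (P j) (lin (suc j)) (lin (suc (suc j)))))))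

  numerWith-lastStepTerms : ∀ n m → numerWith (suc m) (lastStepTerms n m) ≋ ((X *ₚ Xⁿ n) *ₚ (P m *ₚ lin (suc m)))
  numerWith-lastStepTerms n m =
    ≋-trans (numerWith-lastStepTerms≋up+nonUp n m)
      (≋-trans (+ₚ-cong (≋-refl {Xⁿ n *ₚ (down *ₚ lin (suc m))}) (numerWith-nonUpTerms n m))
        (last-step-identity polyRing X (Xⁿ n) [ b m ] [ a (suc m) ] [ lam (suc m) ] (lin (suc m)) down (P m) (P (suc m))
          (lin≋ (suc m)) (three-term-recurrence m)))
    where
    down : Poly
    down = lin m *ₚ proj₁ (PP m)

  numerWith-head : ∀ n m → scaleₚ 1# (xpow (suc n) (P m *ₚ linProd m (suc m))) ≋
    ((X *ₚ Xⁿ n) *ₚ (P m *ₚ lin (suc m)))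
  numerWith-head n m = ≋-trans (scaleₚ-xpow 1# (suc n) _) (≋-trans (ℙ.*-identityˡ _)
    (ℙ.*-cong (Xⁿ-suc n) (*ₚ-congʳ (P m) (linProd-next m))))

  lastStepCombo-representsZero : ∀ n m → RepresentsZero (lastStepCombo n m)
  lastStepCombo-representsZero n m rewrite maxM-lastStepCombo n m =
    coeff-≈ (≋-trans (+ₚ-cong (numerWith-head n m) (numerWith-negateCoeffs (suc m) (lastStepTerms n m)))
      (≋-trans (+ₚ-cong (≋-refl {top}) (negₚ-cong (numerWith-lastStepTerms n m))) (ℙ.-‿inverseʳ top)))
    where
    top : Poly
    top = (X *ₚ Xⁿ n) *ₚ (P m *ₚ lin (suc m))

  functional⇒lastStepRecurrence : ∀ {Lv} → IsFunctionalL Lv → LastStepRecurrence Lv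
  functional⇒lastStepRecurrence {Lv} (kills-zero , L1≈1 , L-vanishes) = record
    { at-origin = L1≈1
    ; above-diagonal = L-vanishes _ _
    ; last-step = λ n m → x∙y⁻¹≈ε⇒x≈y _ _
        (trans (sym (applyL-lastStepCombo Lv n m)) (kills-zero (lastStepCombo n m) (lastStepCombo-representsZero n m)))
    }

module Sums {c ℓ : Level} (F : Field c ℓ) (b a lam : ℕ → Field.Carrier F) where
  open Field F hiding (zero)
  open MS F b a lam

  sumC-map-cong : ∀ {A : Set} (l : List A) {f g : A → Carrier} →
    (∀ x → f x ≈ g x) → sumC (map f l) ≈ sumC (map g l)
  sumC-map-cong [] _ = refl
  sumC-map-cong (x ∷ l) f≈g = +-cong (f≈g x) (sumC-map-cong l f≈g)

  sumC-++ : ∀ xs ys → sumC (xs ++ ys) ≈ sumC xs + sumC ys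
  sumC-++ [] ys = sym (+-identityˡ _)
  sumC-++ (x ∷ xs) ys = trans (+-congˡ (sumC-++ xs ys)) (sym (+-assoc _ _ _))

  sumC-map-0 : ∀ {A : Set} (l : List A) → sumC (map (λ _ → 0#) l) ≈ 0#
  sumC-map-0 [] = refl
  sumC-map-0 (x ∷ l) = trans (+-identityˡ _) (sumC-map-0 l)

  sumC-map-+ : ∀ {A : Set} (l : List A) (f g : A → Carrier) →
    sumC (map (λ x → f x + g x) l) ≈ sumC (map f l) + sumC (map g l)
  sumC-map-+ [] f g = sym (+-identityˡ _)
  sumC-map-+ (x ∷ l) f g = trans (+-congˡ (sumC-map-+ l f g)) (interchange _ _ _ _)
    where open import Algebra.Properties.CommutativeSemigroup +-commutativeSemigroup using (interchange)

  sumC-map-* : ∀ {A : Set} (l : List A) (k : Carrier) (f : A → Carrier) →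
    sumC (map (λ x → k * f x) l) ≈ k * sumC (map f l)
  sumC-map-* [] k f = sym (zeroʳ k)
  sumC-map-* (x ∷ l) k f = trans (+-congˡ (sumC-map-* l k f)) (sym (distribˡ k _ _))

  sumC-map-concatMap : ∀ {A B : Set} (f : B → Carrier) (g : A → List B) (l : List A) →
    sumC (map f (concatMap g l)) ≈ sumC (map (λ x → sumC (map f (g x))) l)
  sumC-map-concatMap f g [] = refl
  sumC-map-concatMap f g (x ∷ l) = begin
    sumC (map f (g x ++ concatMap g l))                 ≡⟨ ≡.cong sumC (LP.map-++ f (g x) (concatMap g l)) ⟩
    sumC (map f (g x) ++ map f (concatMap g l))         ≈⟨ sumC-++ (map f (g x)) _ ⟩
    sumC (map f (g x)) + sumC (map f (concatMap g l))   ≈⟨ +-congˡ (sumC-map-concatMap f g l) ⟩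
    sumC (map f (g x)) + sumC (map (λ x → sumC (map f (g x))) l) ∎
    where open import Relation.Binary.Reasoning.Setoid setoid

  sumC-map-swap : ∀ {A B : Set} (xs : List A) (ys : List B) (f : A → B → Carrier) →
    sumC (map (λ x → sumC (map (f x) ys)) xs) ≈ sumC (map (λ y → sumC (map (λ x → f x y) xs)) ys)
  sumC-map-swap [] ys f = sym (sumC-map-0 ys)
  sumC-map-swap (x ∷ xs) ys f =
    trans (+-congˡ (sumC-map-swap xs ys f)) (sym (sumC-map-+ ys (f x) (λ y → sumC (map (λ x → f x y) xs))))

module Paths {c ℓ : Level} (F : Field c ℓ) (b a lam : ℕ → Field.Carrier F) where
  open Field F hiding (zero)
  open MS F b a lam
  open LastStep F b a lam
  open Sums F b a lam

  Outcome : Set c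
  Outcome = Maybe (ℕ × ℕ × Carrier)

  outcomeSetoid : Setoid c (c ⊔ ℓ)
  outcomeSetoid = Maybeₚ.setoid (×-setoid (≡.setoid ℕ) (×-setoid (≡.setoid ℕ) setoid))
  open Setoid outcomeSetoid using ()
    renaming (_≈_ to _≈ₒ_; reflexive to ≈ₒ-reflexive; sym to ≈ₒ-sym; trans to ≈ₒ-trans)

  select : ∀ {p q} {A : Set p} {B : Set q} → Dec A → Dec B → Carrier → Carrier
  select d d′ w = if does d ∧ does d′ then w else 0#

  select-scaled : ∀ {p q} {A : Set p} {B : Set q} (d : Dec A) (d′ : Dec B) w c c′ →
    (B → c ≈ c′) → select d d′ (w * c) ≈ c′ * select d d′ w
  select-scaled (yes _) (yes β) w c c′ c≈c′ = trans (*-comm w c) (*-congʳ (c≈c′ β))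
  select-scaled (yes _) (no _) w c c′ _ = sym (zeroʳ c′)
  select-scaled (no _) d′ w c c′ _ = sym (zeroʳ c′)

  select-off : ∀ {p q} {A : Set p} {B : Set q} (d : Dec A) (d′ : Dec B) w →
    (A → B → ⊥) → select d d′ w ≈ 0#
  select-off (yes α) (yes β) w ¬αβ = ⊥-elim (¬αβ α β)
  select-off (yes _) (no _) w _ = refl
  select-off (no _) d′ w _ = refl

  select-cong : ∀ {p q} {A : Set p} {B : Set q} (d : Dec A) (d′ : Dec B) {w w′} →
    w ≈ w′ → select d d′ w ≈ select d d′ w′
  select-cong (yes _) (yes _) w≈w′ = w≈w′
  select-cong (yes _) (no _) _ = refl
  select-cong (no _) d′ _ = refl

  weightAt : ℕ → ℕ → Outcome → Carrier
  weightAt n m nothing = 0#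
  weightAt n m (just (x , e , w)) = select (x ≟ n) (e ≟ m) w

  weightAt-cong : ∀ n m {r r′} → r ≈ₒ r′ → weightAt n m r ≈ weightAt n m r′
  weightAt-cong n m nothing = refl
  weightAt-cong n m {just (x , e , _)} (just (≡.refl , ≡.refl , w≈w′)) = select-cong (x ≟ n) (e ≟ m) w≈w′

  contrib≡weightAt-walk : ∀ n m w → contrib n m w ≡ weightAt n m (walk 0 w)
  contrib≡weightAt-walk n m w with walk 0 w
  ... | nothing = ≡.refl
  ... | just _ = ≡.refl

  extend : Outcome → Step → Outcome
  extend nothing s = nothing
  extend (just (x , e , w)) U = just (suc x , suc e , w * 1#)
  extend (just (x , e , w)) H = just (suc x , e , w * b e)
  extend (just (x , zero , w)) V = nothing
  extend (just (x , suc e , w)) V = just (x , e , w * a (suc e))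
  extend (just (x , zero , w)) D = nothing
  extend (just (x , suc e , w)) D = just (suc x , e , w * lam (suc e))

  shift : ℕ → Carrier → Outcome → Outcome
  shift x₀ w₀ nothing = nothing
  shift x₀ w₀ (just (x , e , w)) = just (x₀ ℕ.+ x , e , w₀ * w)

  foldl-extend-nothing : ∀ w → foldl extend nothing w ≡ nothing
  foldl-extend-nothing [] = ≡.refl
  foldl-extend-nothing (s ∷ w) = foldl-extend-nothing w

  -- walk consumes a word from the front, the fold of extend from the back.
  foldl-extend≈shift-walk : ∀ w h x₀ w₀ → foldl extend (just (x₀ , h , w₀)) w ≈ₒ shift x₀ w₀ (walk h w)
  foldl-extend≈shift-walk [] h x₀ w₀ = just (≡.sym (ℕₚ.+-identityʳ x₀) , ≡.refl , sym (*-identityʳ w₀))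
  foldl-extend≈shift-walk (U ∷ w) h x₀ w₀ with walk (suc h) w | foldl-extend≈shift-walk w (suc h) (suc x₀) (w₀ * 1#)
  ... | nothing | ih = ih
  ... | just (x , e , wt) | ih = ≈ₒ-trans ih (just (≡.sym (ℕₚ.+-suc x₀ x) , ≡.refl , *-assoc _ _ _))
  foldl-extend≈shift-walk (H ∷ w) h x₀ w₀ with walk h w | foldl-extend≈shift-walk w h (suc x₀) (w₀ * b h)
  ... | nothing | ih = ih
  ... | just (x , e , wt) | ih = ≈ₒ-trans ih (just (≡.sym (ℕₚ.+-suc x₀ x) , ≡.refl , *-assoc _ _ _))
  foldl-extend≈shift-walk (V ∷ w) zero x₀ w₀ = ≈ₒ-reflexive (foldl-extend-nothing w)
  foldl-extend≈shift-walk (V ∷ w) (suc h) x₀ w₀ with walk h w | foldl-extend≈shift-walk w h x₀ (w₀ * a (suc h))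
  ... | nothing | ih = ih
  ... | just (x , e , wt) | ih = ≈ₒ-trans ih (just (≡.refl , ≡.refl , *-assoc _ _ _))
  foldl-extend≈shift-walk (D ∷ w) zero x₀ w₀ = ≈ₒ-reflexive (foldl-extend-nothing w)
  foldl-extend≈shift-walk (D ∷ w) (suc h) x₀ w₀ with walk h w | foldl-extend≈shift-walk w h (suc x₀) (w₀ * lam (suc h))
  ... | nothing | ih = ih
  ... | just (x , e , wt) | ih = ≈ₒ-trans ih (just (≡.sym (ℕₚ.+-suc x₀ x) , ≡.refl , *-assoc _ _ _))

  run : List Step → Outcome
  run = foldl extend (just (0 , 0 , 1#))

  run-snoc : ∀ w s → run (w ++ s ∷ []) ≡ extend (run w) s
  run-snoc w s = LP.foldl-++ extend _ w (s ∷ [])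

  contrib≈weightAt-run : ∀ n m w → contrib n m w ≈ weightAt n m (run w)
  contrib≈weightAt-run n m w = trans (reflexive (contrib≡weightAt-walk n m w))
    (weightAt-cong n m (≈ₒ-sym (≈ₒ-trans
      (foldl-extend≈shift-walk w 0 0 1#) (shift-unit (walk 0 w)))))
    where
    shift-unit : ∀ r → shift 0 1# r ≈ₒ r
    shift-unit nothing = nothing
    shift-unit (just (x , e , w)) = just (≡.refl , ≡.refl , *-identityˡ w)

  weightAt-extend-U : ∀ n m r → weightAt (suc n) m (extend r U) ≈ viaUp (λ n′ m′ → weightAt n′ m′ r) n m
  weightAt-extend-U n zero nothing = refl
  weightAt-extend-U n (suc m) nothing = refl
  weightAt-extend-U n zero (just (x , e , w)) = select-off (suc x ≟ suc n) (suc e ≟ 0) _ (λ _ ())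
  weightAt-extend-U n (suc m) (just (x , e , w)) =
    trans (select-scaled (x ≟ n) (e ≟ m) w 1# 1# (λ _ → refl)) (*-identityˡ _)

  weightAt-extend-H : ∀ n m r → weightAt (suc n) m (extend r H) ≈ b m * weightAt n m r
  weightAt-extend-H n m nothing = sym (zeroʳ _)
  weightAt-extend-H n m (just (x , e , w)) =
    select-scaled (x ≟ n) (e ≟ m) w (b e) (b m) (λ e≡m → reflexive (≡.cong b e≡m))

  weightAt-extend-V : ∀ n m r → weightAt (suc n) m (extend r V) ≈ a (suc m) * weightAt (suc n) (suc m) r
  weightAt-extend-V n m nothing = sym (zeroʳ _)
  weightAt-extend-V n m (just (x , zero , w)) =
    trans (sym (zeroʳ _)) (*-congˡ (sym (select-off (x ≟ suc n) (0 ≟ suc m) w (λ _ ()))))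
  weightAt-extend-V n m (just (x , suc e , w)) =
    select-scaled (x ≟ suc n) (e ≟ m) w (a (suc e)) (a (suc m)) (λ e≡m → reflexive (≡.cong (a ∘ suc) e≡m))

  weightAt-extend-D : ∀ n m r → weightAt (suc n) m (extend r D) ≈ lam (suc m) * weightAt n (suc m) r
  weightAt-extend-D n m nothing = sym (zeroʳ _)
  weightAt-extend-D n m (just (x , zero , w)) =
    trans (sym (zeroʳ _)) (*-congˡ (sym (select-off (x ≟ n) (0 ≟ suc m) w (λ _ ()))))
  weightAt-extend-D n m (just (x , suc e , w)) =
    select-scaled (x ≟ n) (e ≟ m) w (lam (suc e)) (lam (suc m)) (λ e≡m → reflexive (≡.cong (lam ∘ suc) e≡m))

  stepSum : (Step → Carrier) → Carrier
  stepSum g = sumC (map g allSteps)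

  stepSum-weightAt-extend : ∀ n m r →
    stepSum (λ s → weightAt (suc n) m (extend r s)) ≈ viaLastStep (λ n′ m′ → weightAt n′ m′ r) n m
  stepSum-weightAt-extend n m r =
    +-cong (weightAt-extend-U n m r) (+-cong (weightAt-extend-H n m r)
      (+-cong (weightAt-extend-V n m r) (trans (+-identityʳ _) (weightAt-extend-D n m r))))

  stepSum-contrib-snoc : ∀ n m w →
    stepSum (λ s → contrib (suc n) m (w ++ s ∷ [])) ≈ viaLastStep (λ n′ m′ → contrib n′ m′ w) n m
  stepSum-contrib-snoc n m w = begin
    stepSum (λ s → contrib (suc n) m (w ++ s ∷ []))
      ≈⟨ sumC-map-cong allSteps (λ s → trans (contrib≈weightAt-run (suc n) m (w ++ s ∷ []))
           (reflexive (≡.cong (weightAt (suc n) m) (run-snoc w s)))) ⟩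
    stepSum (λ s → weightAt (suc n) m (extend (run w) s))
      ≈⟨ stepSum-weightAt-extend n m (run w) ⟩
    viaLastStep (λ n′ m′ → weightAt n′ m′ (run w)) n m
      ≈⟨ viaLastStep-cong (λ k → contrib≈weightAt-run n k w) (contrib≈weightAt-run (suc n) (suc m) w) ⟨
    viaLastStep (λ n′ m′ → contrib n′ m′ w) n m
      ∎
    where open import Relation.Binary.Reasoning.Setoid setoid

  2+h+2x≡h+2[1+x] : ∀ h x → suc (suc (h ℕ.+ (x ℕ.+ x))) ≡ h ℕ.+ (suc x ℕ.+ suc x)
  2+h+2x≡h+2[1+x] = solve-∀

  WithinBounds : ℕ → ℕ → Outcome → Set
  WithinBounds h len nothing = ⊤
  WithinBounds h len (just (x , e , _)) = len ℕ.+ e ≤ h ℕ.+ (x ℕ.+ x) × e ≤ h ℕ.+ x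

  walk-withinBounds : ∀ h w → WithinBounds h (length w) (walk h w)
  walk-withinBounds h [] = ℕₚ.m≤m+n h 0 , ℕₚ.m≤m+n h 0
  walk-withinBounds h (U ∷ w) with walk (suc h) w | walk-withinBounds (suc h) w
  ... | nothing | _ = _
  ... | just (x , e , _) | (p , q) =
    ℕₚ.≤-trans (s≤s p) (ℕₚ.≤-reflexive (2+h+2x≡h+2[1+x] h x)) ,
    ℕₚ.≤-trans q (ℕₚ.≤-reflexive (≡.sym (ℕₚ.+-suc h x)))
  walk-withinBounds h (H ∷ w) with walk h w | walk-withinBounds h w
  ... | nothing | _ = _
  ... | just (x , e , _) | (p , q) =
    ℕₚ.≤-trans (s≤s p) (ℕₚ.≤-trans (ℕₚ.n≤1+n _) (ℕₚ.≤-reflexive (2+h+2x≡h+2[1+x] h x))) ,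
    ℕₚ.≤-trans q (ℕₚ.+-monoʳ-≤ h (ℕₚ.n≤1+n x))
  walk-withinBounds zero (V ∷ w) = _
  walk-withinBounds (suc h) (V ∷ w) with walk h w | walk-withinBounds h w
  ... | nothing | _ = _
  ... | just (x , e , _) | (p , q) = s≤s p , ℕₚ.m≤n⇒m≤1+n q
  walk-withinBounds zero (D ∷ w) = _
  walk-withinBounds (suc h) (D ∷ w) with walk h w | walk-withinBounds h w
  ... | nothing | _ = _
  ... | just (x , e , _) | (p , q) =
    s≤s (ℕₚ.≤-trans p (ℕₚ.≤-trans (ℕₚ.n≤1+n _)
      (ℕₚ.≤-trans (ℕₚ.n≤1+n _) (ℕₚ.≤-reflexive (2+h+2x≡h+2[1+x] h x))))) ,
    ℕₚ.m≤n⇒m≤1+n (ℕₚ.≤-trans q (ℕₚ.+-monoʳ-≤ h (ℕₚ.n≤1+n x)))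

  contrib-vanishes : ∀ n m w → (length w ℕ.+ m ≤ n ℕ.+ n → m ≤ n → ⊥) → contrib n m w ≈ 0#
  contrib-vanishes n m w out =
    trans (reflexive (contrib≡weightAt-walk n m w)) (outside (walk 0 w) (walk-withinBounds 0 w))
    where
    outside : ∀ r → WithinBounds 0 (length w) r → weightAt n m r ≈ 0#
    outside nothing _ = refl
    outside (just (x , e , wt)) (p , q) = select-off (x ≟ n) (e ≟ m) wt λ { ≡.refl ≡.refl → out p q }

  contrib-vanishes-long : ∀ n m w → suc (n ℕ.+ n) ≤ length w → contrib n m w ≈ 0#
  contrib-vanishes-long n m w long = contrib-vanishes n m w λ p _ →
    ℕₚ.<-irrefl ≡.refl (ℕₚ.≤-trans long (ℕₚ.≤-trans (ℕₚ.m≤m+n (length w) m) p))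

  contrib-vanishes-above-diagonal : ∀ {n m} w → n < m → contrib n m w ≈ 0#
  contrib-vanishes-above-diagonal {n} {m} w n<m = contrib-vanishes n m w λ _ m≤n → ℕₚ.<⇒≱ n<m m≤n

module PathSums {c ℓ : Level} (F : Field c ℓ) (b a lam : ℕ → Field.Carrier F) where
  open Field F hiding (zero)
  open MS F b a lam
  open LastStep F b a lam
  open Sums F b a lam
  open Paths F b a lam

  wordsSum : ℕ → (List Step → Carrier) → Carrier
  wordsSum k f = sumC (map f (words k))

  wordsSum-cong : ∀ k {f g} → (∀ w → f w ≈ g w) → wordsSum k f ≈ wordsSum k g
  wordsSum-cong k = sumC-map-cong (words k)

  wordsSum-suc : ∀ k f → wordsSum (suc k) f ≈ wordsSum k (λ w → stepSum (λ s → f (s ∷ w)))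
  wordsSum-suc k f = sumC-map-concatMap f (λ w → map (_∷ w) allSteps) (words k)

  wordsSum-snoc : ∀ k f → wordsSum (suc k) f ≈ wordsSum k (λ w → stepSum (λ s → f (w ++ s ∷ [])))
  wordsSum-snoc zero f = wordsSum-suc zero f
  wordsSum-snoc (suc k) f = begin
    wordsSum (suc (suc k)) f
      ≈⟨ wordsSum-suc (suc k) f ⟩
    wordsSum (suc k) (λ w → stepSum (λ s → f (s ∷ w)))
      ≈⟨ wordsSum-snoc k _ ⟩
    wordsSum k (λ w → stepSum (λ t → stepSum (λ s → f (s ∷ w ++ t ∷ []))))
      ≈⟨ wordsSum-cong k (λ w → sumC-map-swap allSteps allSteps (λ t s → f (s ∷ w ++ t ∷ []))) ⟩
    wordsSum k (λ w → stepSum (λ s → stepSum (λ t → f (s ∷ w ++ t ∷ []))))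
      ≈⟨ wordsSum-suc k _ ⟨
    wordsSum (suc k) (λ w → stepSum (λ t → f (w ++ t ∷ [])))
      ∎
    where open import Relation.Binary.Reasoning.Setoid setoid

  wordsSum-vanishes : ∀ k f → (∀ w → length w ≡ k → f w ≈ 0#) → wordsSum k f ≈ 0#
  wordsSum-vanishes zero f f≈0 = trans (+-identityʳ _) (f≈0 [] ≡.refl)
  wordsSum-vanishes (suc k) f f≈0 = trans (wordsSum-suc k f) (wordsSum-vanishes k _ λ w ∣w∣≡k →
    trans (sumC-map-cong allSteps λ s → f≈0 (s ∷ w) (≡.cong suc ∣w∣≡k)) (sumC-map-0 allSteps))

  -- msSum n m is boundedSum (suc (n + n)) (contrib n m) by definition.
  boundedSum : ℕ → (List Step → Carrier) → Carrier
  boundedSum N f = sumC (map (λ k → wordsSum k f) (upTo N))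

  boundedSum-cong : ∀ N {f g} → (∀ w → f w ≈ g w) → boundedSum N f ≈ boundedSum N g
  boundedSum-cong N f≈g = sumC-map-cong (upTo N) (λ k → wordsSum-cong k f≈g)

  boundedSum-0 : ∀ N → boundedSum N (λ _ → 0#) ≈ 0#
  boundedSum-0 N = trans (sumC-map-cong (upTo N) (λ k → sumC-map-0 (words k))) (sumC-map-0 (upTo N))

  boundedSum-+ : ∀ N f g → boundedSum N (λ w → f w + g w) ≈ boundedSum N f + boundedSum N g
  boundedSum-+ N f g =
    trans (sumC-map-cong (upTo N) (λ k → sumC-map-+ (words k) f g)) (sumC-map-+ (upTo N) _ _)

  boundedSum-* : ∀ N k f → boundedSum N (λ w → k * f w) ≈ k * boundedSum N f
  boundedSum-* N k f =
    trans (sumC-map-cong (upTo N) (λ j → sumC-map-* (words j) k f)) (sumC-map-* (upTo N) k _)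

  boundedSum-suc : ∀ N f → boundedSum (suc N) f ≈ boundedSum N f + wordsSum N f
  boundedSum-suc N f = begin
    boundedSum (suc N) f                                  ≡⟨ ≡.cong (sumC ∘ map g) (LP.upTo-∷ʳ N) ⟨
    sumC (map g (upTo N ++ N ∷ []))                       ≡⟨ ≡.cong sumC (LP.map-++ g (upTo N) (N ∷ [])) ⟩
    sumC (map g (upTo N) ++ g N ∷ [])                     ≈⟨ sumC-++ (map g (upTo N)) (g N ∷ []) ⟩
    boundedSum N f + (g N + 0#)                           ≈⟨ +-congˡ (+-identityʳ _) ⟩
    boundedSum N f + wordsSum N f                         ∎
    where
    open import Relation.Binary.Reasoning.Setoid setoid
    g : ℕ → Carrier
    g k = wordsSum k f

  boundedSum-extend : ∀ {N N′} f → (∀ w → N ≤ length w → f w ≈ 0#) → N ≤ N′ →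
    boundedSum N′ f ≈ boundedSum N f
  boundedSum-extend {N} f f≈0 N≤N′ = extend′ (ℕₚ.≤⇒≤′ N≤N′)
    where
    extend′ : ∀ {N′} → N ℕ.≤′ N′ → boundedSum N′ f ≈ boundedSum N f
    extend′ ℕ.≤′-refl = refl
    extend′ (ℕ.≤′-step {N′} N≤′N′) = trans (boundedSum-suc N′ f) (trans (+-congˡ
      (wordsSum-vanishes N′ f λ w ∣w∣≡N′ →
        f≈0 w (ℕₚ.≤-trans (ℕₚ.≤′⇒≤ N≤′N′) (ℕₚ.≤-reflexive (≡.sym ∣w∣≡N′)))))
      (trans (+-identityʳ _) (extend′ N≤′N′)))

  boundedSum-snoc : ∀ N f →
    boundedSum (suc N) f ≈ f [] + boundedSum N (λ w → stepSum (λ s → f (w ++ s ∷ [])))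
  boundedSum-snoc N f = +-cong (+-identityʳ _) (begin
    sumC (map g (applyUpTo suc N))         ≡⟨ ≡.cong sumC (LP.map-applyUpTo suc g N) ⟩
    sumC (applyUpTo (g ∘ suc) N)           ≡⟨ ≡.cong sumC (LP.map-applyUpTo (λ k → k) (g ∘ suc) N) ⟨
    sumC (map (g ∘ suc) (upTo N))          ≈⟨ sumC-map-cong (upTo N) (λ k → wordsSum-snoc k f) ⟩
    boundedSum N (λ w → stepSum (λ s → f (w ++ s ∷ []))) ∎)
    where
    open import Relation.Binary.Reasoning.Setoid setoid
    g : ℕ → Carrier
    g k = wordsSum k f

  boundedSum-viaLastStep : ∀ N (C : List Step → Table) n m →
    boundedSum N (λ w → viaLastStep (C w) n m) ≈ viaLastStep (λ n′ m′ → boundedSum N (λ w → C w n′ m′)) n m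
  boundedSum-viaLastStep N C n m =
    trans (boundedSum-+ N _ _) (+-cong (viaUp-sum m) (trans (boundedSum-+ N _ _)
      (+-cong (boundedSum-* N _ _) (trans (boundedSum-+ N _ _) (+-cong (boundedSum-* N _ _) (boundedSum-* N _ _))))))
    where
    viaUp-sum : ∀ m →
      boundedSum N (λ w → viaUp (C w) n m) ≈ viaUp (λ n′ m′ → boundedSum N (λ w → C w n′ m′)) n m
    viaUp-sum zero = boundedSum-0 N
    viaUp-sum (suc m) = refl

  msSum-lastStepRecurrence : LastStepRecurrence msSum
  msSum-lastStepRecurrence = record
    { at-origin = trans (+-identityʳ _) (+-identityʳ _)
    ; above-diagonal = λ {n} n<m →
        trans (boundedSum-cong (suc (n ℕ.+ n)) (λ w → contrib-vanishes-above-diagonal w n<m))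
              (boundedSum-0 (suc (n ℕ.+ n)))
    ; last-step = last-step
    }
    where
    open import Relation.Binary.Reasoning.Setoid setoid
    last-step : ∀ n m → msSum (suc n) m ≈ viaLastStep msSum n m
    last-step n m = begin
      msSum (suc n) m
        -- one more word length, so that dropping the last step lands on the cut-off K
        ≈⟨ boundedSum-extend _ (contrib-vanishes-long (suc n) m) (ℕₚ.n≤1+n K) ⟨
      boundedSum (suc K) (contrib (suc n) m)
        ≈⟨ boundedSum-snoc K _ ⟩
      0# + boundedSum K (λ w → stepSum (λ s → contrib (suc n) m (w ++ s ∷ [])))
        ≈⟨ trans (+-identityˡ _) (boundedSum-cong K (stepSum-contrib-snoc n m)) ⟩
      boundedSum K (λ w → viaLastStep (λ n′ m′ → contrib n′ m′ w) n m)
        ≈⟨ boundedSum-viaLastStep K (λ w n′ m′ → contrib n′ m′ w) n m ⟩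
      viaLastStep (λ n′ m′ → boundedSum K (contrib n′ m′)) n m
        ≈⟨ viaLastStep-cong (λ k → boundedSum-extend _ (contrib-vanishes-long n k) K-bound) refl ⟩
      viaLastStep msSum n m
        ∎
      where
      K : ℕ
      K = suc (suc n ℕ.+ suc n)
      K-bound : suc (n ℕ.+ n) ≤ K
      K-bound = s≤s (ℕₚ.+-mono-≤ (ℕₚ.n≤1+n n) (ℕₚ.n≤1+n n))

-- The non-degeneracy hypotheses are what make L exist.
theorem3p6 : ∀ {c ℓ : Level} (F : Field c ℓ) (b a lam : ℕ → Field.Carrier F) →
    (∀ n → 1 ≤ n → ¬ (Field._≈_ F (a n) (Field.0# F))) →
    (∀ n → 1 ≤ n → ¬ (Field._≈_ F (MS.eval F b a lam (MS.P F b a lam n) (Field.-_ F (Field._*_ F (lam n) (Field._⁻¹ F (a n))))) (Field.0# F))) →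
    (Lv : ℕ → ℕ → Field.Carrier F) → MS.IsFunctionalL F b a lam Lv →
    ∀ n m → Field._≈_ F (Lv n m) (MS.msSum F b a lam n m)
theorem3p6 F b a lam _ _ Lv isL =
  lastStep-unique (functional⇒lastStepRecurrence isL) msSum-lastStepRecurrence
  where
  open LastStep F b a lam
  open Moments F b a lam
  open PathSums F b a lam
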